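{- Let $p$ be a prime, $F$ a free pro-$p$ group on $x_1,\dots,x_r$ and $m\ge1$. Then the restriction of $\tau_m^\theta$ to $\mathrm{A}_F(m)$ equals $\theta_{m+1}\circ\tau_m$, i.e. for every $\phi\in\mathrm{A}_F(m)$ and $h\in H$, $\tau_m^\theta(\phi)(h)=\theta_{m+1}(\tau_m(\phi)(h))$.
   Context: $I_F$ is the augmentation ideal of $\mathbb{F}_p[[F]]$, $F_n=\{f\mid f-1\in I_F^n\}$, $H=F/F_2$ with basis $X_j=x_j\bmod F_2$. $\mathrm{A}_F(m)=\{\phi\in\mathrm{Aut}(F)\mid\phi(f)f^{ -1}\in F_{m+1}\ \forall f\}$; for $\phi\in\mathrm{A}_F(m)$, $\tau_m(\phi):H\to F_{m+1}/F_{m+2}$, $[f]\mapsto\phi(f)f^{ -1}\bmod F_{m+2}$. $\widehat U=\mathbb{F}_p\langle\langle X_1,\dots,X_r\rangle\rangle=\prod_{n\ge0}H^{\otimes n}$; $\theta:\mathbb{F}_p[[F]]\to\widehat U$ is the continuous algebra isomorphism with $\theta(x_j)=1+X_j$; $\theta_n(f)$ is the degree-$n$ component of $\theta(f)$, and $\theta_{m+1}:F_{m+1}/F_{m+2}\to H^{\otimes(m+1)}$, $f\bmod F_{m+2}\mapsto\theta_{m+1}(f)$ (injective linear map). For $\phi\in\mathrm{Aut}(F)$: $[\phi]\in\mathrm{GL}(H)$ induced, acting on $\widehat U$ by $[\phi]^{\otimes n}$ on $H^{\otimes n}$; $\widehat\phi$ the induced automorphism of $\mathbb{F}_p[[F]]$;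 $\kappa^\theta(\phi)=\theta\circ\widehat\phi\circ\theta^{ -1}\circ[\phi]^{ -1}$; $\tau^\theta(\phi)=\kappa^\theta(\phi)|_H-\mathrm{id}_H$; $\tau_m^\theta(\phi):H\to H^{\otimes(m+1)}$ its degree-$(m+1)$ component. -}

module Defs where

-- Free pro-p group F on x_1..x_r, realised through the Magnus/θ picture:
--   Û = F_p⟨⟨X_1..X_r⟩⟩ is represented as coefficient functions on words
--   (List (Fin r) → ℕ), with coefficients read modulo p.
--   θ(x_j) = 1 + X_j, and F ≅ θ(F) = closure in Û of the abstract group
--   generated by the 1 + X_j (degree/X-adic topology).

open import Data.Nat using (ℕ; zero; suc; _+_; _*_; _∸_; _≤_; _<_)
open import Data.Fin using (Fin)
open import Data.Fin.Properties using () renaming (_≟_ to _≟ᶠ_)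
open import Data.List using (List; []; _∷_; map; foldr; concat; concatMap; allFin; length)
open import Data.Product using (Σ; _×_; _,_; ∃)
open import Data.Bool using (Bool; true; false; if_then_else_)
open import Relation.Nullary using (does)
open import Relation.Binary.PropositionalEquality using (_≡_)

_≡[_]_ : ℕ → ℕ → ℕ → Set
a ≡[ p ] b = Σ ℕ λ k → Σ ℕ λ l → a + k * p ≡ b + l * p

neg : ℕ → ℕ → ℕ
neg p a = (p ∸ 1) * a

Word : ℕ → Set
Word r = List (Fin r)

Series : ℕ → Set
Series r = Word r → ℕ

_≈[_]_ : {r : ℕ} → Series r → ℕ → Series r → Set
s ≈[ p ] t = ∀ w → s w ≡[ p ] t w

sumL : List ℕ → ℕ
sumL = foldr _+_ 0

splits : {A : Set} → List A → List (List A × List A)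
splits [] = ([] , []) ∷ []
splits (a ∷ w) = ([] , a ∷ w) ∷ map (λ { (u , v) → (a ∷ u , v) }) (splits w)

mulS : {r : ℕ} → Series r → Series r → Series r
mulS s t w = sumL (map (λ { (u , v) → s u * t v }) (splits w))

oneS : {r : ℕ} → Series r
oneS [] = 1
oneS (_ ∷ _) = 0

prodS : {r : ℕ} → List (Series r) → Series r
prodS [] = oneS
prodS (a ∷ as) = mulS a (prodS as)

wordsOfLen : (r n : ℕ) → List (Word r)
wordsOfLen r zero = [] ∷ []
wordsOfLen r (suc n) = concatMap (λ i → map (i ∷_) (wordsOfLen r n)) (allFin r)

wordsUpTo : (r n : ℕ) → List (Word r)
wordsUpTo r zero = wordsOfLen r zero
wordsUpTo r (suc n) = wordsUpTo r n Data.List.++ wordsOfLen r (suc n)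
  where import Data.List

oneMinus : {r : ℕ} → ℕ → Series r → Series r
oneMinus p s [] = 1 + neg p (s [])
oneMinus p s (x ∷ w) = neg p (s (x ∷ w))

minusOne : {r : ℕ} → ℕ → Series r → Series r
minusOne p s [] = s [] + neg p 1
minusOne p s (x ∷ w) = s (x ∷ w)

-- inverse of a series with constant term 1 (mod p): Σ_k (1 - s)^k,
-- truncated at k ≤ |w| (higher terms vanish mod p in degree |w|)
replicateL : {A : Set} → ℕ → A → List A
replicateL zero a = []
replicateL (suc k) a = a ∷ replicateL k a

invS : {r : ℕ} → ℕ → Series r → Series r
invS p s w = sumL (map (λ k → prodS (replicateL k (oneMinus p s)) w) (upTo (suc (length w))))
  where open import Data.List using (upTo)

-- θ(x_j) = 1 + X_j and θ(x_j^{-1}) = Σ_k (-X_j)^k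
genS : {r : ℕ} → Fin r → Series r
genS j [] = 1
genS j (i ∷ []) = if does (i ≟ᶠ j) then 1 else 0
genS j (i ∷ k ∷ w) = 0

allEq : {r : ℕ} → Fin r → Word r → Bool
allEq j [] = true
allEq j (i ∷ w) = if does (i ≟ᶠ j) then allEq j w else false

signPow : ℕ → ℕ → ℕ
signPow p zero = 1
signPow p (suc k) = neg p (signPow p k)

genInvS : {r : ℕ} → ℕ → Fin r → Series r
genInvS p j w = if allEq j w then signPow p (length w) else 0

-- abstract group words in x_j^{±1} and their θ-image
GroupWord : ℕ → Set
GroupWord r = List (Fin r × Bool)

evalGW : {r : ℕ} → ℕ → GroupWord r → Series r
evalGW p g = prodS (map (λ { (j , true) → genS j ; (j , false) → genInvS p j }) g)

-- θ(F): s lies in the closure of the group generated by the 1 + X_j,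
-- i.e. it is approximated to every degree by an abstract group word
InF : {r : ℕ} → ℕ → Series r → Set
InF {r} p s = ∀ n → Σ (GroupWord r) λ g →
  ∀ (w : Word r) → length w ≤ n → s w ≡[ p ] evalGW p g w

-- Zassenhaus filtration F_n = {f | f - 1 ∈ I_F^n}; under θ, I_F^n is the
-- ideal of series with no terms of degree < n
InFn : {r : ℕ} → ℕ → ℕ → Series r → Set
InFn {r} p n s = InF p s × (∀ (w : Word r) → length w < n → minusOne p s w ≡[ p ] 0)

-- substitution X_j ↦ y_j - 1: this is θ ∘ φ̂ ∘ θ⁻¹ for the (continuous)
-- endomorphism φ with θ(φ(x_j)) = y_j.  Terms with |u| > |w| vanish mod p.
substS : {r : ℕ} → ℕ → (Fin r → Series r) → Series r → Series r
substS {r} p y s w =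
  sumL (map (λ u → s u * prodS (map (λ i → minusOne p (y i)) u) w) (wordsUpTo r (length w)))

-- φ ∈ Aut(F), given by the θ-images y_j = θ(φ(x_j)) of the generators
IsAut : {r : ℕ} → ℕ → (Fin r → Series r) → Set
IsAut {r} p y =
  (∀ j → InF p (y j))
  × (∀ s → InF p s → InF p (substS p y s))
  × (∀ s s' → InF p s → InF p s' → substS p y s ≈[ p ] substS p y s' → s ≈[ p ] s')
  × (∀ t → InF p t → Σ (Series r) λ s → InF p s × substS p y s ≈[ p ] t)

commS : {r : ℕ} → ℕ → (Fin r → Series r) → Series r → Series r
commS p y f = mulS (substS p y f) (invS p f)

InA : {r : ℕ} → ℕ → (Fin r → Series r) → ℕ → Set
InA {r} p y m = ∀ f → InF p f → InFn p (suc m) (commS p y f)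

-- H = F_p^r with basis X_j; elements as coefficient vectors
Hvec : ℕ → Set
Hvec r = Fin r → ℕ

sumFin : {r : ℕ} → (Fin r → ℕ) → ℕ
sumFin {r} g = sumL (map g (allFin r))

-- [φ] ∈ GL(H):  [φ](X_j) = Σ_i (coefficient of X_i in y_j) X_i
linAct : {r : ℕ} → (Fin r → Series r) → Hvec r → Hvec r
linAct y h i = sumFin (λ j → y j (i ∷ []) * h j)

-- class [f] ∈ H = F/F_2, i.e. θ_1(f)
theta1 : {r : ℕ} → Series r → Hvec r
theta1 f i = f (i ∷ [])

linS : {r : ℕ} → Hvec r → Series r
linS h [] = 0
linS h (i ∷ []) = h i
linS h (i ∷ j ∷ w) = 0

-- τ^θ(φ)(h) = κ^θ(φ)(h) - h, where κ^θ(φ)(h) = (θ∘φ̂∘θ⁻¹)([φ]⁻¹ h);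
-- the argument h' is [φ]⁻¹ h (characterised by [φ] h' = h)
tauThetaS : {r : ℕ} → ℕ → (Fin r → Series r) → Hvec r → Hvec r → Series r
tauThetaS p y h h' w = substS p y (linS h') w + neg p (linS h w)

module Submission where

-- Write y_i = θ(φ(x_i)) and z_i = y_i - 1.  Applying the defining
-- property of A_F(m) to the generators shows z_i ≡ X_i in all degrees ≤ m.
-- Consequently the substituted monomial z_u = z_{u_1} ⋯ z_{u_k} agrees with
-- the word u itself in degrees ≤ m, and also in degree m+1 unless |u| = 1.
-- Hence, for a word w of length m+1,
--   (θφ̂θ⁻¹ s)(w) ≡ s(w) + Σ_i s(X_i) y_i(w),          and ≡ s below degree m+1.
-- For s = θ(f) the product with θ(f)⁻¹ therefore has degree-(m+1) coefficient
-- Σ_i f(X_i) y_i(w); for s = [φ]⁻¹h ∈ H the same sum appears, because [φ]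
-- is the identity on H when m ≥ 1, and the coefficients of [φ]⁻¹h are h_i.
--
-- Primality of p is only used to know that p is positive.

open import Defs
open import Data.Nat using (ℕ; zero; suc; _+_; _*_; _≤_; _<_; z≤n; s≤s; ≢-nonZero⁻¹)
open import Data.Nat.Properties
open import Data.Nat.Tactic.RingSolver using (solve-∀)
open import Data.Nat.DivMod using (_%_; _/_; %-distribˡ-+; %-distribˡ-*; m*n%n≡0; m≡m%n+[m/n]*n; [m+kn]%n≡m%n)
open import Data.Nat.Primality using (Prime; prime⇒nonZero)
open import Data.Fin using (Fin) renaming (zero to fz; suc to fs)
open import Data.Fin.Properties using () renaming (_≟_ to _≟ᶠ_; suc-injective to fs-injective)
open import Data.List using (List; []; _∷_; map; length; _++_; concatMap; allFin; applyUpTo)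
open import Data.List.Properties using (map-++; map-tabulate; length-++)
open import Data.Product using (_,_; proj₁; proj₂)
open import Data.Bool using (Bool; true; false; if_then_else_)
open import Data.Empty using (⊥-elim)
open import Data.Sum using (inj₁; inj₂)
open import Level using (0ℓ)
open import Relation.Nullary using (Dec; does; yes; no; ¬_)
open import Relation.Binary.Bundles using (Setoid)
import Relation.Binary.Reasoning.Setoid as SetoidReasoning
open import Relation.Binary.PropositionalEquality

private variable
  A B : Set
  r : ℕ

sumL-++ : (xs ys : List ℕ) → sumL (xs ++ ys) ≡ sumL xs + sumL ys
sumL-++ [] ys = refl
sumL-++ (x ∷ xs) ys = trans (cong (x +_) (sumL-++ xs ys)) (sym (+-assoc x _ _))

sum-map-++ : (F : A → ℕ) (xs ys : List A) →
  sumL (map F (xs ++ ys)) ≡ sumL (map F xs) + sumL (map F ys)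
sum-map-++ F xs ys = trans (cong sumL (map-++ F xs ys)) (sumL-++ (map F xs) (map F ys))

sum-cong : (F G : A → ℕ) → (∀ x → F x ≡ G x) → (xs : List A) → sumL (map F xs) ≡ sumL (map G xs)
sum-cong F G e [] = refl
sum-cong F G e (x ∷ xs) = cong₂ _+_ (e x) (sum-cong F G e xs)

sum-zero : (F : A → ℕ) → (∀ x → F x ≡ 0) → (xs : List A) → sumL (map F xs) ≡ 0
sum-zero F z xs = trans (sum-cong F (λ _ → 0) z xs) (zeros xs)
  where
  zeros : (xs : List A) → sumL (map (λ _ → 0) xs) ≡ 0
  zeros [] = refl
  zeros (_ ∷ xs) = zeros xs

+-interchange : ∀ a b c d → a + b + (c + d) ≡ a + c + (b + d)
+-interchange = solve-∀

sum-+ : (F G : A → ℕ) (xs : List A) →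
  sumL (map (λ x → F x + G x) xs) ≡ sumL (map F xs) + sumL (map G xs)
sum-+ F G [] = refl
sum-+ F G (x ∷ xs) =
  trans (cong (F x + G x +_) (sum-+ F G xs)) (+-interchange (F x) (G x) _ _)

sum-map-map : (F : B → ℕ) (G : A → B) (xs : List A) →
  sumL (map F (map G xs)) ≡ sumL (map (λ x → F (G x)) xs)
sum-map-map F G [] = refl
sum-map-map F G (x ∷ xs) = cong (F (G x) +_) (sum-map-map F G xs)

sum-concatMap : (F : B → ℕ) (g : A → List B) (xs : List A) →
  sumL (map F (concatMap g xs)) ≡ sumL (map (λ x → sumL (map F (g x))) xs)
sum-concatMap F g [] = refl
sum-concatMap F g (x ∷ xs) =
  trans (sum-map-++ F (g x) (concatMap g xs)) (cong (sumL (map F (g x)) +_) (sum-concatMap F g xs))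

sumBelow : ℕ → (ℕ → ℕ) → ℕ
sumBelow zero F = 0
sumBelow (suc n) F = F 0 + sumBelow n (λ k → F (suc k))

sumBelow-suc : (n : ℕ) (F : ℕ → ℕ) → sumBelow (suc n) F ≡ sumBelow n F + F n
sumBelow-suc zero F = +-comm (F 0) 0
sumBelow-suc (suc n) F =
  trans (cong (F 0 +_) (sumBelow-suc n (λ k → F (suc k)))) (sym (+-assoc (F 0) _ _))

sum-applyUpTo : (F G : ℕ → ℕ) (n : ℕ) → sumL (map F (applyUpTo G n)) ≡ sumBelow n (λ k → F (G k))
sum-applyUpTo F G zero = refl
sum-applyUpTo F G (suc n) = cong (F (G 0) +_) (sum-applyUpTo F (λ k → G (suc k)) n)

sumFin-suc : (c : Fin (suc r) → ℕ) → sumFin c ≡ c fz + sumFin (λ j → c (fs j))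
sumFin-suc c = cong (λ xs → c fz + sumL xs)
  (trans (map-tabulate fs c) (sym (map-tabulate (λ j → j) (λ j → c (fs j)))))

sumFin-cong : (c d : Fin r → ℕ) → (∀ j → c j ≡ d j) → sumFin c ≡ sumFin d
sumFin-cong {r} c d e = sum-cong c d e (allFin r)

sumFin-zero : (c : Fin r → ℕ) → (∀ j → c j ≡ 0) → sumFin c ≡ 0
sumFin-zero {r} c z = sum-zero c z (allFin r)

sumFin-delta : (i : Fin r) (c : Fin r → ℕ) → (∀ j → j ≢ i → c j ≡ 0) → sumFin c ≡ c i
sumFin-delta fz c z = begin
  sumFin c                         ≡⟨ sumFin-suc c ⟩
  c fz + sumFin (λ j → c (fs j))   ≡⟨ cong (c fz +_) (sumFin-zero _ (λ j → z (fs j) (λ ()))) ⟩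
  c fz + 0                         ≡⟨ +-identityʳ _ ⟩
  c fz                             ∎
  where open ≡-Reasoning
sumFin-delta (fs i) c z = begin
  sumFin c                         ≡⟨ sumFin-suc c ⟩
  c fz + sumFin (λ j → c (fs j))   ≡⟨ cong (_+ sumFin (λ j → c (fs j))) (z fz (λ ())) ⟩
  sumFin (λ j → c (fs j))          ≡⟨ sumFin-delta i (λ j → c (fs j)) (λ j j≢i → z (fs j) (λ e → j≢i (fs-injective e))) ⟩
  c (fs i)                         ∎
  where open ≡-Reasoning

δ : Word r → Word r → ℕ
δ [] [] = 1
δ [] (_ ∷ _) = 0
δ (_ ∷ _) [] = 0
δ (a ∷ u) (b ∷ v) = if does (b ≟ᶠ a) then δ u v else 0

if-yes : {P : Set} {X Y : ℕ} (d : Dec P) → P → (if does d then X else Y) ≡ X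
if-yes (yes _) _ = refl
if-yes (no ¬p) p = ⊥-elim (¬p p)

if-no : {P : Set} {X Y : ℕ} (d : Dec P) → ¬ P → (if does d then X else Y) ≡ Y
if-no (yes p) ¬p = ⊥-elim (¬p p)
if-no (no _) _ = refl

if-same : (b : Bool) → (if b then 0 else 0) ≡ 0
if-same true = refl
if-same false = refl

sum-wordsOfLen-suc : (G : Word r → ℕ) (n : ℕ) →
  sumL (map G (wordsOfLen r (suc n))) ≡ sumFin (λ a → sumL (map (λ u → G (a ∷ u)) (wordsOfLen r n)))
sum-wordsOfLen-suc {r} G n = trans (sum-concatMap G (λ i → map (i ∷_) (wordsOfLen r n)) (allFin r))
  (sumFin-cong _ _ (λ a → sum-map-map G (a ∷_) (wordsOfLen r n)))

sum-wordsOfLen-suc-zero : (G : Word r → ℕ) → (∀ b u → G (b ∷ u) ≡ 0) → (n : ℕ) →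
  sumL (map G (wordsOfLen r (suc n))) ≡ 0
sum-wordsOfLen-suc-zero {r} G z n = trans (sum-wordsOfLen-suc G n)
  (sumFin-zero _ (λ a → sum-zero (λ u → G (a ∷ u)) (z a) (wordsOfLen r n)))

sift-wordsOfLen : (F : Word r → ℕ) (c : Word r) →
  sumL (map (λ u → F u * δ u c) (wordsOfLen r (length c))) ≡ F c
sift-wordsOfLen F [] = trans (+-identityʳ _) (*-identityʳ _)
sift-wordsOfLen {r} F (x ∷ c) = begin
  sumL (map (λ u → F u * δ u (x ∷ c)) (wordsOfLen r (suc (length c))))
    ≡⟨ sum-wordsOfLen-suc (λ u → F u * δ u (x ∷ c)) (length c) ⟩
  sumFin (λ a → sumL (map (λ u → F (a ∷ u) * δ (a ∷ u) (x ∷ c)) (wordsOfLen r (length c))))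
    ≡⟨ sumFin-delta x _ other-letter ⟩
  sumL (map (λ u → F (x ∷ u) * δ (x ∷ u) (x ∷ c)) (wordsOfLen r (length c)))
    ≡⟨ sum-cong _ _ (λ u → cong (F (x ∷ u) *_) (if-yes (x ≟ᶠ x) refl)) (wordsOfLen r (length c)) ⟩
  sumL (map (λ u → F (x ∷ u) * δ u c) (wordsOfLen r (length c)))
    ≡⟨ sift-wordsOfLen (λ u → F (x ∷ u)) c ⟩
  F (x ∷ c) ∎
  where
  open ≡-Reasoning
  other-letter : ∀ a → a ≢ x →
    sumL (map (λ u → F (a ∷ u) * δ (a ∷ u) (x ∷ c)) (wordsOfLen r (length c))) ≡ 0
  other-letter a a≢x = sum-zero _ (λ u → trans (cong (F (a ∷ u) *_)
    (if-no (x ≟ᶠ a) (λ e → a≢x (sym e)))) (*-zeroʳ (F (a ∷ u)))) (wordsOfLen r (length c))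

sift-wordsOfLen-other : (F : Word r → ℕ) (k : ℕ) (c : Word r) → k ≢ length c →
  sumL (map (λ u → F u * δ u c) (wordsOfLen r k)) ≡ 0
sift-wordsOfLen-other F zero [] k≢ = ⊥-elim (k≢ refl)
sift-wordsOfLen-other F zero (x ∷ c) k≢ = trans (+-identityʳ _) (*-zeroʳ (F []))
sift-wordsOfLen-other F (suc k) [] k≢ =
  sum-wordsOfLen-suc-zero (λ u → F u * δ u []) (λ b u → *-zeroʳ (F (b ∷ u))) k
sift-wordsOfLen-other {r} F (suc k) (x ∷ c) k≢ =
  trans (sum-wordsOfLen-suc (λ u → F u * δ u (x ∷ c)) k) (sumFin-zero _ first-letter)
  where
  first-letter : ∀ a → sumL (map (λ u → F (a ∷ u) * δ (a ∷ u) (x ∷ c)) (wordsOfLen r k)) ≡ 0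
  first-letter a with x ≟ᶠ a
  ... | yes refl = sift-wordsOfLen-other (λ u → F (x ∷ u)) k c (λ e → k≢ (cong suc e))
  ... | no _ = sum-zero _ (λ u → *-zeroʳ (F (a ∷ u))) (wordsOfLen r k)

sift-wordsUpTo-short : (F : Word r → ℕ) (n : ℕ) (c : Word r) → n < length c →
  sumL (map (λ u → F u * δ u c) (wordsUpTo r n)) ≡ 0
sift-wordsUpTo-short F zero c n<c = sift-wordsOfLen-other F zero c (λ e → <-irrefl e n<c)
sift-wordsUpTo-short {r} F (suc n) c n<c =
  trans (sum-map-++ _ (wordsUpTo r n) (wordsOfLen r (suc n)))
    (cong₂ _+_ (sift-wordsUpTo-short F n c (<-trans (n<1+n n) n<c))
               (sift-wordsOfLen-other F (suc n) c (λ e → <-irrefl e n<c)))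

sift-wordsUpTo : (F : Word r → ℕ) (n : ℕ) (c : Word r) → length c ≤ n →
  sumL (map (λ u → F u * δ u c) (wordsUpTo r n)) ≡ F c
sift-wordsUpTo F zero [] _ = sift-wordsOfLen F []
sift-wordsUpTo {r} F (suc n) c c≤n with m≤n⇒m<n∨m≡n c≤n
... | inj₁ (s≤s c≤n′) = trans (sum-map-++ _ (wordsUpTo r n) (wordsOfLen r (suc n)))
  (trans (cong₂ _+_ (sift-wordsUpTo F n c c≤n′)
                    (sift-wordsOfLen-other F (suc n) c (λ e → <-irrefl (sym e) (s≤s c≤n′))))
         (+-identityʳ _))
... | inj₂ c≡1+n = trans (sum-map-++ _ (wordsUpTo r n) (wordsOfLen r (suc n)))
  (cong₂ _+_ (sift-wordsUpTo-short F n c (≤-reflexive (sym c≡1+n)))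
             (subst (λ k → sumL (map (λ u → F u * δ u c) (wordsOfLen r k)) ≡ F c) c≡1+n
                    (sift-wordsOfLen F c)))

sum-wordsUpTo-letters : (G : Word r → ℕ) → G [] ≡ 0 → (∀ a b u → G (a ∷ b ∷ u) ≡ 0) → (n : ℕ) →
  sumL (map G (wordsUpTo r (suc n))) ≡ sumFin (λ i → G (i ∷ []))
sum-wordsUpTo-letters {r} G G[] Glong zero = begin
  sumL (map G (wordsUpTo r 1))                      ≡⟨ sum-map-++ G (wordsUpTo r 0) (wordsOfLen r 1) ⟩
  (G [] + 0) + sumL (map G (wordsOfLen r 1))        ≡⟨ cong₂ _+_ (cong (_+ 0) G[]) (sum-wordsOfLen-suc G 0) ⟩
  sumFin (λ i → G (i ∷ []) + 0)                     ≡⟨ sumFin-cong _ (λ i → G (i ∷ [])) (λ i → +-identityʳ _) ⟩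
  sumFin (λ i → G (i ∷ []))                         ∎
  where open ≡-Reasoning
sum-wordsUpTo-letters {r} G G[] Glong (suc n) = begin
  sumL (map G (wordsUpTo r (2 + n)))
    ≡⟨ sum-map-++ G (wordsUpTo r (suc n)) (wordsOfLen r (2 + n)) ⟩
  sumL (map G (wordsUpTo r (suc n))) + sumL (map G (wordsOfLen r (2 + n)))
    ≡⟨ cong₂ _+_ (sum-wordsUpTo-letters G G[] Glong n) long ⟩
  sumFin (λ i → G (i ∷ [])) + 0
    ≡⟨ +-identityʳ _ ⟩
  sumFin (λ i → G (i ∷ [])) ∎
  where
  open ≡-Reasoning
  long : sumL (map G (wordsOfLen r (2 + n))) ≡ 0
  long = trans (sum-wordsOfLen-suc G (suc n))
    (sumFin-zero _ (λ a → sum-wordsOfLen-suc-zero _ (Glong a) n))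

mulS-cons : (s t : Series r) (x : Fin r) (b : Word r) →
  mulS s t (x ∷ b) ≡ s [] * t (x ∷ b) + mulS (λ c → s (x ∷ c)) t b
mulS-cons s t x b = cong (s [] * t (x ∷ b) +_) (sum-map-map _ _ (splits b))

mulS-zeroˡ : (t : Series r) (b : Word r) → mulS (λ _ → 0) t b ≡ 0
mulS-zeroˡ t [] = refl
mulS-zeroˡ t (x ∷ b) = trans (mulS-cons (λ _ → 0) t x b) (mulS-zeroˡ t b)

mulS-zeroʳ : (s : Series r) (b : Word r) → mulS s (λ _ → 0) b ≡ 0
mulS-zeroʳ s [] = cong (_+ 0) (*-zeroʳ (s []))
mulS-zeroʳ s (x ∷ b) = trans (mulS-cons s (λ _ → 0) x b)
  (cong₂ _+_ (*-zeroʳ (s [])) (mulS-zeroʳ (λ c → s (x ∷ c)) b))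

mulS-identityˡ : (t : Series r) (b : Word r) → mulS oneS t b ≡ t b
mulS-identityˡ t [] = trans (+-identityʳ _) (+-identityʳ _)
mulS-identityˡ t (x ∷ b) = trans (mulS-cons oneS t x b)
  (trans (cong₂ _+_ (+-identityʳ _) (mulS-zeroˡ t b)) (+-identityʳ _))

mulS-identityʳ : (s : Series r) (b : Word r) → mulS s oneS b ≡ s b
mulS-identityʳ s [] = trans (+-identityʳ _) (*-identityʳ _)
mulS-identityʳ s (x ∷ b) = trans (mulS-cons s oneS x b)
  (trans (cong (_+ mulS (λ c → s (x ∷ c)) oneS b) (*-zeroʳ (s []))) (mulS-identityʳ (λ c → s (x ∷ c)) b))

mulS-distribʳ : (s s′ t : Series r) (b : Word r) →
  mulS (λ c → s c + s′ c) t b ≡ mulS s t b + mulS s′ t b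
mulS-distribʳ s s′ t [] = begin
  (s [] + s′ []) * t [] + 0          ≡⟨ +-identityʳ _ ⟩
  (s [] + s′ []) * t []              ≡⟨ *-distribʳ-+ (t []) (s []) (s′ []) ⟩
  s [] * t [] + s′ [] * t []         ≡⟨ sym (cong₂ _+_ (+-identityʳ (s [] * t [])) (+-identityʳ (s′ [] * t []))) ⟩
  s [] * t [] + 0 + (s′ [] * t [] + 0) ∎
  where open ≡-Reasoning
mulS-distribʳ s s′ t (x ∷ b) = begin
  mulS (λ c → s c + s′ c) t (x ∷ b)
    ≡⟨ mulS-cons (λ c → s c + s′ c) t x b ⟩
  (s [] + s′ []) * t (x ∷ b) + mulS (λ c → s (x ∷ c) + s′ (x ∷ c)) t b
    ≡⟨ cong₂ _+_ (*-distribʳ-+ (t (x ∷ b)) (s []) (s′ [])) (mulS-distribʳ (λ c → s (x ∷ c)) (λ c → s′ (x ∷ c)) t b) ⟩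
  (s [] * t (x ∷ b) + s′ [] * t (x ∷ b)) + (mulS (λ c → s (x ∷ c)) t b + mulS (λ c → s′ (x ∷ c)) t b)
    ≡⟨ +-interchange (s [] * t (x ∷ b)) _ _ _ ⟩
  (s [] * t (x ∷ b) + mulS (λ c → s (x ∷ c)) t b) + (s′ [] * t (x ∷ b) + mulS (λ c → s′ (x ∷ c)) t b)
    ≡⟨ sym (cong₂ _+_ (mulS-cons s t x b) (mulS-cons s′ t x b)) ⟩
  mulS s t (x ∷ b) + mulS s′ t (x ∷ b) ∎
  where open ≡-Reasoning

mulS-distribˡ : (s t t′ : Series r) (b : Word r) →
  mulS s (λ v → t v + t′ v) b ≡ mulS s t b + mulS s t′ b
mulS-distribˡ s t t′ [] = begin
  s [] * (t [] + t′ []) + 0          ≡⟨ +-identityʳ _ ⟩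
  s [] * (t [] + t′ [])              ≡⟨ *-distribˡ-+ (s []) (t []) (t′ []) ⟩
  s [] * t [] + s [] * t′ []         ≡⟨ sym (cong₂ _+_ (+-identityʳ (s [] * t [])) (+-identityʳ (s [] * t′ []))) ⟩
  s [] * t [] + 0 + (s [] * t′ [] + 0) ∎
  where open ≡-Reasoning
mulS-distribˡ s t t′ (x ∷ b) = begin
  mulS s (λ v → t v + t′ v) (x ∷ b)
    ≡⟨ mulS-cons s _ x b ⟩
  s [] * (t (x ∷ b) + t′ (x ∷ b)) + mulS (λ c → s (x ∷ c)) (λ v → t v + t′ v) b
    ≡⟨ cong₂ _+_ (*-distribˡ-+ (s []) (t (x ∷ b)) (t′ (x ∷ b))) (mulS-distribˡ (λ c → s (x ∷ c)) t t′ b) ⟩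
  (s [] * t (x ∷ b) + s [] * t′ (x ∷ b)) + (mulS (λ c → s (x ∷ c)) t b + mulS (λ c → s (x ∷ c)) t′ b)
    ≡⟨ +-interchange (s [] * t (x ∷ b)) _ _ _ ⟩
  (s [] * t (x ∷ b) + mulS (λ c → s (x ∷ c)) t b) + (s [] * t′ (x ∷ b) + mulS (λ c → s (x ∷ c)) t′ b)
    ≡⟨ sym (cong₂ _+_ (mulS-cons s t x b) (mulS-cons s t′ x b)) ⟩
  mulS s t (x ∷ b) + mulS s t′ (x ∷ b) ∎
  where open ≡-Reasoning

mulS-sumBelowʳ : (s : Series r) (n : ℕ) (T : ℕ → Series r) (b : Word r) →
  mulS s (λ v → sumBelow n (λ k → T k v)) b ≡ sumBelow n (λ k → mulS s (T k) b)
mulS-sumBelowʳ s zero T b = mulS-zeroʳ s b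
mulS-sumBelowʳ s (suc n) T b = trans (mulS-distribˡ s (T 0) (λ v → sumBelow n (λ k → T (suc k) v)) b)
  (cong (mulS s (T 0) b +_) (mulS-sumBelowʳ s n (λ k → T (suc k)) b))

mulS-congˡ : {s s′ : Series r} (t : Series r) → (∀ c → s c ≡ s′ c) → (b : Word r) →
  mulS s t b ≡ mulS s′ t b
mulS-congˡ t e [] = cong (λ a → a * t [] + 0) (e [])
mulS-congˡ {s = s} {s′} t e (x ∷ b) = begin
  mulS s t (x ∷ b)                                   ≡⟨ mulS-cons s t x b ⟩
  s [] * t (x ∷ b) + mulS (λ c → s (x ∷ c)) t b      ≡⟨ cong₂ _+_ (cong (_* t (x ∷ b)) (e [])) (mulS-congˡ t (λ c → e (x ∷ c)) b) ⟩
  s′ [] * t (x ∷ b) + mulS (λ c → s′ (x ∷ c)) t b    ≡⟨ sym (mulS-cons s′ t x b) ⟩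
  mulS s′ t (x ∷ b)                                  ∎
  where open ≡-Reasoning

δ-nil : (c : Word r) → δ [] c ≡ oneS c
δ-nil [] = refl
δ-nil (x ∷ c) = refl

δ-mul : (a : Fin r) (u b : Word r) → mulS (δ (a ∷ [])) (δ u) b ≡ δ (a ∷ u) b
δ-mul a u [] = refl
δ-mul a u (x ∷ b) with x ≟ᶠ a
... | yes refl = begin
  mulS (δ (x ∷ [])) (δ u) (x ∷ b)              ≡⟨ mulS-cons (δ (x ∷ [])) (δ u) x b ⟩
  0 + mulS (λ c → δ (x ∷ []) (x ∷ c)) (δ u) b  ≡⟨ mulS-congˡ (δ u) (λ c → trans (if-yes (x ≟ᶠ x) refl) (δ-nil c)) b ⟩
  mulS oneS (δ u) b                            ≡⟨ mulS-identityˡ (δ u) b ⟩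
  δ u b                                        ∎
  where open ≡-Reasoning
... | no x≢a = begin
  mulS (δ (a ∷ [])) (δ u) (x ∷ b)              ≡⟨ mulS-cons (δ (a ∷ [])) (δ u) x b ⟩
  0 + mulS (λ c → δ (a ∷ []) (x ∷ c)) (δ u) b  ≡⟨ mulS-congˡ (δ u) (λ c → if-no (x ≟ᶠ a) x≢a) b ⟩
  mulS (λ _ → 0) (δ u) b                       ≡⟨ mulS-zeroˡ (δ u) b ⟩
  0                                            ∎
  where open ≡-Reasoning

+-swapʳ : ∀ a b c → a + b + c ≡ a + c + b
+-swapʳ = solve-∀

-- Everything below works modulo an arbitrary positive integer p = q + 1.
module Modular (q : ℕ) where

  p : ℕ
  p = suc q

  -- Congruence modulo p, wrapped in a record so that both sides stay inferable.
  infix 4 _≈_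
  record _≈_ (a b : ℕ) : Set where
    constructor mod-eq
    field mod-eq⁻¹ : a % p ≡ b % p

  ≈-refl : ∀ {a} → a ≈ a
  ≈-refl = mod-eq refl

  ≈-sym : ∀ {a b} → a ≈ b → b ≈ a
  ≈-sym (mod-eq e) = mod-eq (sym e)

  ≈-trans : ∀ {a b c} → a ≈ b → b ≈ c → a ≈ c
  ≈-trans (mod-eq e) (mod-eq e′) = mod-eq (trans e e′)

  ≡⇒≈ : ∀ {a b} → a ≡ b → a ≈ b
  ≡⇒≈ refl = ≈-refl

  ≈-setoid : Setoid 0ℓ 0ℓ
  ≈-setoid = record
    { Carrier = ℕ ; _≈_ = _≈_
    ; isEquivalence = record { refl = ≈-refl ; sym = ≈-sym ; trans = ≈-trans } }

  open SetoidReasoning ≈-setoid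

  +-≈ : ∀ {a b c d} → a ≈ b → c ≈ d → a + c ≈ b + d
  +-≈ {a} {b} {c} {d} (mod-eq e₁) (mod-eq e₂) = mod-eq (trans (%-distribˡ-+ a c p)
    (trans (cong₂ (λ u v → (u + v) % p) e₁ e₂) (sym (%-distribˡ-+ b d p))))

  *-≈ : ∀ {a b c d} → a ≈ b → c ≈ d → a * c ≈ b * d
  *-≈ {a} {b} {c} {d} (mod-eq e₁) (mod-eq e₂) = mod-eq (trans (%-distribˡ-* a c p)
    (trans (cong₂ (λ u v → (u * v) % p) e₁ e₂) (sym (%-distribˡ-* b d p))))

  ≈0⇒*≈0 : ∀ {a} b → a ≈ 0 → a * b ≈ 0
  ≈0⇒*≈0 b a≈0 = *-≈ a≈0 (≈-refl {b})

  neg-inverse : ∀ a → a + neg p a ≈ 0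
  neg-inverse a = mod-eq (trans (cong (_% p) (*-comm p a)) (m*n%n≡0 a p))

  +-cancelʳ-≈ : ∀ {a b} c → a + c ≈ b + c → a ≈ b
  +-cancelʳ-≈ {a} {b} c e = begin
    a                  ≡⟨ sym (+-identityʳ a) ⟩
    a + 0              ≈⟨ +-≈ (≈-refl {a}) (≈-sym (neg-inverse c)) ⟩
    a + (c + neg p c)  ≡⟨ sym (+-assoc a c _) ⟩
    a + c + neg p c    ≈⟨ +-≈ e (≈-refl {neg p c}) ⟩
    b + c + neg p c    ≡⟨ +-assoc b c _ ⟩
    b + (c + neg p c)  ≈⟨ +-≈ (≈-refl {b}) (neg-inverse c) ⟩
    b + 0              ≡⟨ +-identityʳ b ⟩
    b                  ∎

  ≈⇒≡[p] : ∀ {a b} → a ≈ b → a ≡[ p ] b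
  -- (a = a%p + (a/p)p and b = b%p + (b/p)p, so a + (b/p)p = b + (a/p)p.)
  ≈⇒≡[p] {a} {b} (mod-eq e) = b / p , a / p ,
    trans (cong (_+ b / p * p) (m≡m%n+[m/n]*n a p))
      (trans (cong (λ u → u + a / p * p + b / p * p) e)
        (trans (+-swapʳ (b % p) (a / p * p) (b / p * p))
          (cong (_+ a / p * p) (sym (m≡m%n+[m/n]*n b p)))))

  ≡[p]⇒≈ : ∀ {a b} → a ≡[ p ] b → a ≈ b
  ≡[p]⇒≈ {a} {b} (k , l , e) =
    mod-eq (trans (sym ([m+kn]%n≡m%n a k p)) (trans (cong (_% p) e) ([m+kn]%n≡m%n b l p)))

  sum-cong-≈ : (F G : A → ℕ) → (∀ x → F x ≈ G x) → (xs : List A) → sumL (map F xs) ≈ sumL (map G xs)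
  sum-cong-≈ F G e [] = ≈-refl
  sum-cong-≈ F G e (x ∷ xs) = +-≈ (e x) (sum-cong-≈ F G e xs)

  sumFin-cong-≈ : (c d : Fin r → ℕ) → (∀ j → c j ≈ d j) → sumFin c ≈ sumFin d
  sumFin-cong-≈ {r} c d e = sum-cong-≈ c d e (allFin r)

  mulS-cong-splits : (s s′ t t′ : Series r) (b : Word r) →
    (∀ u v → u ++ v ≡ b → s u * t v ≈ s′ u * t′ v) → mulS s t b ≈ mulS s′ t′ b
  mulS-cong-splits s s′ t t′ [] e = +-≈ (e [] [] refl) (≈-refl {0})
  mulS-cong-splits s s′ t t′ (x ∷ b) e = begin
    mulS s t (x ∷ b)                                  ≡⟨ mulS-cons s t x b ⟩
    s [] * t (x ∷ b) + mulS (λ c → s (x ∷ c)) t b     ≈⟨ +-≈ (e [] (x ∷ b) refl) tail ⟩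
    s′ [] * t′ (x ∷ b) + mulS (λ c → s′ (x ∷ c)) t′ b ≡⟨ sym (mulS-cons s′ t′ x b) ⟩
    mulS s′ t′ (x ∷ b)                                ∎
    where
    tail : mulS (λ c → s (x ∷ c)) t b ≈ mulS (λ c → s′ (x ∷ c)) t′ b
    tail = mulS-cong-splits (λ c → s (x ∷ c)) (λ c → s′ (x ∷ c)) t t′ b (λ u v uv≡b → e (x ∷ u) v (cong (x ∷_) uv≡b))

  split-length : (u v b : Word r) → u ++ v ≡ b → length u + length v ≡ length b
  split-length u v b uv≡b = trans (sym (length-++ u)) (cong length uv≡b)

  mulS-cong : (s s′ t t′ : Series r) (b : Word r) →
    (∀ c → length c ≤ length b → s c ≈ s′ c) → (∀ d → length d ≤ length b → t d ≈ t′ d) →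
    mulS s t b ≈ mulS s′ t′ b
  mulS-cong s s′ t t′ b es et = mulS-cong-splits s s′ t t′ b (λ u v uv≡b →
    let |u|+|v|≡|b| = split-length u v b uv≡b in
    *-≈ (es u (subst (length u ≤_) |u|+|v|≡|b| (m≤m+n (length u) (length v))))
        (et v (subst (length v ≤_) |u|+|v|≡|b| (m≤n+m (length v) (length u)))))

  mulS-cong-augmented : (s s′ t t′ : Series r) (b : Word r) →
    s [] ≈ 0 → s′ [] ≈ 0 → t [] ≈ 0 → t′ [] ≈ 0 →
    (∀ c → length c < length b → s c ≈ s′ c) → (∀ d → length d < length b → t d ≈ t′ d) →
    mulS s t b ≈ mulS s′ t′ b
  mulS-cong-augmented s s′ t t′ b s₀ s′₀ t₀ t′₀ es et = mulS-cong-splits s s′ t t′ b term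
    where
    term : ∀ u v → u ++ v ≡ b → s u * t v ≈ s′ u * t′ v
    term [] v _ = ≈-trans (≈0⇒*≈0 (t v) s₀) (≈-sym (≈0⇒*≈0 (t′ v) s′₀))
    term (a ∷ u) [] _ = begin
      s (a ∷ u) * t []    ≡⟨ *-comm (s (a ∷ u)) (t []) ⟩
      t [] * s (a ∷ u)    ≈⟨ ≈0⇒*≈0 (s (a ∷ u)) t₀ ⟩
      0                   ≈⟨ ≈-sym (≈0⇒*≈0 (s′ (a ∷ u)) t′₀) ⟩
      t′ [] * s′ (a ∷ u)  ≡⟨ *-comm (t′ []) (s′ (a ∷ u)) ⟩
      s′ (a ∷ u) * t′ []  ∎
    term (a ∷ u) (d ∷ v) uv≡b = *-≈
      (es (a ∷ u) (subst (length (a ∷ u) <_) |uv|≡|b| (m<m+n (length (a ∷ u)) (s≤s z≤n))))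
      (et (d ∷ v) (subst (length (d ∷ v) <_) |uv|≡|b| (m<n+m (length (d ∷ v)) (s≤s z≤n))))
      where |uv|≡|b| = split-length (a ∷ u) (d ∷ v) b uv≡b

  mulS-vanish : (s t : Series r) (b : Word r) → s [] ≈ 0 →
    (∀ d → length d < length b → t d ≈ 0) → mulS s t b ≈ 0
  mulS-vanish s t b s₀ t-low =
    ≈-trans (mulS-cong-splits s (λ _ → 0) t t b term) (≡⇒≈ (mulS-zeroˡ t b))
    where
    term : ∀ u v → u ++ v ≡ b → s u * t v ≈ 0
    term [] v _ = ≈0⇒*≈0 (t v) s₀
    term (a ∷ u) v uv≡b = begin
      s (a ∷ u) * t v   ≈⟨ *-≈ (≈-refl {s (a ∷ u)}) (t-low v (subst (length v <_) (split-length (a ∷ u) v b uv≡b) (m<n+m (length v) (s≤s z≤n)))) ⟩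
      s (a ∷ u) * 0     ≡⟨ *-zeroʳ (s (a ∷ u)) ⟩
      0                 ∎

  mulS-exchange-top : (A B J : Series r) (b : Word r) → (∀ c → length c < length b → A c ≈ B c) →
    mulS A J b + B b * J [] ≈ mulS B J b + A b * J []
  mulS-exchange-top A B J [] _ = ≡⇒≈ (swap (A [] * J []) (B [] * J []))
    where
    swap : ∀ a b → a + 0 + b ≡ b + 0 + a
    swap = solve-∀
  mulS-exchange-top A B J (x ∷ b) e = begin
    mulS A J (x ∷ b) + B (x ∷ b) * J []
      ≡⟨ trans (cong (_+ B (x ∷ b) * J []) (mulS-cons A J x b)) (+-assoc (A [] * J (x ∷ b)) _ _) ⟩
    A [] * J (x ∷ b) + (mulS (λ c → A (x ∷ c)) J b + B (x ∷ b) * J [])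
      ≈⟨ +-≈ (*-≈ (e [] (s≤s z≤n)) (≈-refl {J (x ∷ b)}))
             (mulS-exchange-top (λ c → A (x ∷ c)) (λ c → B (x ∷ c)) J b (λ c l → e (x ∷ c) (s≤s l))) ⟩
    B [] * J (x ∷ b) + (mulS (λ c → B (x ∷ c)) J b + A (x ∷ b) * J [])
      ≡⟨ sym (trans (cong (_+ A (x ∷ b) * J []) (mulS-cons B J x b)) (+-assoc (B [] * J (x ∷ b)) _ _)) ⟩
    mulS B J (x ∷ b) + A (x ∷ b) * J [] ∎

  mulS-cancelʳ : (A B J : Series r) (n : ℕ) → J [] ≈ 1 →
    (∀ w → length w ≤ n → mulS A J w ≈ mulS B J w) → ∀ w → length w ≤ n → A w ≈ B w
  mulS-cancelʳ A B J n J₀ AJ≈BJ w |w|≤n = agree-below (suc n) ≤-refl w (s≤s |w|≤n)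
    where
    agree-below : ∀ k → k ≤ suc n → ∀ w → length w < k → A w ≈ B w
    agree-below (suc k) k<1+n w (s≤s |w|≤k) = ≈-sym (+-cancelʳ-≈ (mulS A J w) (begin
      B w + mulS A J w         ≡⟨ +-comm (B w) _ ⟩
      mulS A J w + B w         ≡⟨ cong (mulS A J w +_) (sym (*-identityʳ (B w))) ⟩
      mulS A J w + B w * 1     ≈⟨ +-≈ (≈-refl {mulS A J w}) (*-≈ (≈-refl {B w}) (≈-sym J₀)) ⟩
      mulS A J w + B w * J []  ≈⟨ mulS-exchange-top A B J w (λ c |c|<|w| → agree-below k (<⇒≤ k<1+n) c (<-≤-trans |c|<|w| |w|≤k)) ⟩
      mulS B J w + A w * J []  ≈⟨ +-≈ (≈-sym (AJ≈BJ w (≤-trans |w|≤k (≤-pred k<1+n)))) (*-≈ (≈-refl {A w}) J₀) ⟩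
      mulS A J w + A w * 1     ≡⟨ trans (cong (mulS A J w +_) (*-identityʳ (A w))) (+-comm _ (A w)) ⟩
      A w + mulS A J w         ∎))

  sumBelow-vanishing-tail : (F : ℕ → ℕ) (a : ℕ) → (∀ k → a < k → F k ≈ 0) →
    ∀ N → a ≤ N → sumBelow (suc N) F ≈ sumBelow (suc a) F
  sumBelow-vanishing-tail F a F-tail N a≤N with m≤n⇒m<n∨m≡n a≤N
  ... | inj₂ refl = ≈-refl
  sumBelow-vanishing-tail F a F-tail (suc N) _ | inj₁ (s≤s a≤N) = begin
    sumBelow (2 + N) F             ≡⟨ sumBelow-suc (suc N) F ⟩
    sumBelow (suc N) F + F (suc N) ≈⟨ +-≈ (sumBelow-vanishing-tail F a F-tail N a≤N) (F-tail (suc N) (s≤s a≤N)) ⟩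
    sumBelow (suc a) F + 0         ≡⟨ +-identityʳ _ ⟩
    sumBelow (suc a) F             ∎

  -- invS is a right inverse for series with constant term 1: writing
  -- g = 1 - f, invS f agrees in degree |w| with Σ_{k ≤ N} gᵏ for every N ≥ |w|
  -- (gᵏ vanishes below degree k), and (1 - g) Σ_{k ≤ N} gᵏ = 1 - g^{N+1}.
  module Inverse (f : Series r) (f₀ : f [] ≈ 1) where
    g : Series r
    g = oneMinus p f

    g^ : ℕ → Series r
    g^ k = prodS (replicateL k g)

    g₀ : g [] ≈ 0
    g₀ = ≈-trans (+-≈ (≈-refl {1}) (*-≈ (≈-refl {q}) f₀)) (neg-inverse 1)

    g^-vanish : ∀ k (v : Word r) → length v < k → g^ k v ≈ 0
    g^-vanish (suc k) v (s≤s |v|≤k) =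
      mulS-vanish g (g^ k) v g₀ (λ d |d|<|v| → g^-vanish k d (<-≤-trans |d|<|v| |v|≤k))

    f+g≈1 : ∀ c → f c + g c ≈ oneS c
    f+g≈1 [] = begin
      f [] + (1 + neg p (f []))  ≡⟨ +-suc (f []) _ ⟩
      1 + (f [] + neg p (f []))  ≈⟨ +-≈ (≈-refl {1}) (neg-inverse (f [])) ⟩
      1                          ∎
    f+g≈1 (x ∷ c) = neg-inverse (f (x ∷ c))

    invS≡ : ∀ v → invS p f v ≡ sumBelow (suc (length v)) (λ k → g^ k v)
    invS≡ v = sum-applyUpTo (λ k → g^ k v) (λ k → k) (suc (length v))

    invS-truncation : ∀ N (v : Word r) → length v ≤ N → invS p f v ≈ sumBelow (suc N) (λ k → g^ k v)
    invS-truncation N v |v|≤N = ≈-trans (≡⇒≈ (invS≡ v))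
      (≈-sym (sumBelow-vanishing-tail (λ k → g^ k v) (length v) (λ k → g^-vanish k v) N |v|≤N))

    inverse : ∀ w → mulS f (invS p f) w ≈ oneS w
    inverse w = +-cancelʳ-≈ tail (begin
      mulS f I w + tail                    ≈⟨ +-≈ (≈-refl {mulS f I w}) (≈-sym g·I≈tail) ⟩
      mulS f I w + mulS g I w              ≡⟨ sym (mulS-distribʳ f g I w) ⟩
      mulS (λ c → f c + g c) I w           ≈⟨ mulS-cong _ oneS I I w (λ c _ → f+g≈1 c) (λ _ _ → ≈-refl) ⟩
      mulS oneS I w                        ≡⟨ trans (mulS-identityˡ I w) (invS≡ w) ⟩
      oneS w + tail                        ∎)
      where
      N = length w
      I = invS p f
      tail = sumBelow N (λ k → g^ (suc k) w)
      g·I≈tail : mulS g I w ≈ tail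
      g·I≈tail = begin
        mulS g I w
          ≈⟨ mulS-cong g g I (λ v → sumBelow (suc N) (λ k → g^ k v)) w (λ _ _ → ≈-refl) (invS-truncation N) ⟩
        mulS g (λ v → sumBelow (suc N) (λ k → g^ k v)) w
          ≡⟨ trans (mulS-sumBelowʳ g (suc N) g^ w) (sumBelow-suc N (λ k → g^ (suc k) w)) ⟩
        tail + g^ (suc N) w
          ≈⟨ +-≈ (≈-refl {tail}) (g^-vanish (suc N) w ≤-refl) ⟩
        tail + 0
          ≡⟨ +-identityʳ tail ⟩
        tail ∎

  open Inverse using (inverse)

  -- Elements of θ(F) have constant term 1: this holds for images of group
  -- words, and an element of θ(F) agrees with one of them in degree 0.
  evalGW-nil : (g : GroupWord r) → evalGW p g [] ≡ 1
  evalGW-nil [] = refl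
  evalGW-nil ((j , true) ∷ g) = trans (+-identityʳ _) (trans (+-identityʳ _) (evalGW-nil g))
  evalGW-nil ((j , false) ∷ g) = trans (+-identityʳ _) (trans (+-identityʳ _) (evalGW-nil g))

  InF-constant : (s : Series r) → InF p s → s [] ≈ 1
  InF-constant s s∈F = let (g , s≈g) = s∈F 0 in
    ≈-trans (≡[p]⇒≈ (s≈g [] z≤n)) (≡⇒≈ (evalGW-nil g))

  genS-InF : (j : Fin r) → InF p (genS j)
  genS-InF j n = ((j , true) ∷ []) , λ w _ → ≈⇒≡[p] (≡⇒≈ (sym (mulS-identityʳ (genS j) w)))

  minusOne≈0 : (s : Series r) (w : Word r) → minusOne p s w ≡[ p ] 0 → s w ≈ oneS w
  minusOne≈0 s [] e = +-cancelʳ-≈ (neg p 1) (≈-trans (≡[p]⇒≈ e) (≈-sym (neg-inverse 1)))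
  minusOne≈0 s (x ∷ w) e = ≡[p]⇒≈ e

  zMonomial : (Fin r → Series r) → Word r → Series r
  zMonomial y u = prodS (map (λ i → minusOne p (y i)) u)

  substS-genS : (y : Fin r → Series r) (i : Fin r) (x : Fin r) (w : Word r) →
    substS p y (genS i) (x ∷ w) ≈ y i (x ∷ w)
  substS-genS {r} y i x w = begin
    substS p y (genS i) (x ∷ w)
      ≡⟨ sum-wordsUpTo-letters (λ u → genS i u * z u (x ∷ w)) refl (λ a b u → refl) (length w) ⟩
    sumFin (λ j → genS i (j ∷ []) * z (j ∷ []) (x ∷ w))
      ≡⟨ sumFin-delta i _ (λ j j≢i → cong (_* z (j ∷ []) (x ∷ w)) (if-no (j ≟ᶠ i) j≢i)) ⟩
    genS i (i ∷ []) * z (i ∷ []) (x ∷ w)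
      ≡⟨ cong (_* z (i ∷ []) (x ∷ w)) (if-yes (i ≟ᶠ i) refl) ⟩
    1 * z (i ∷ []) (x ∷ w)
      ≡⟨ trans (*-identityˡ _) (mulS-identityʳ (minusOne p (y i)) (x ∷ w)) ⟩
    y i (x ∷ w) ∎
    where z = zMonomial y

  -- φ ∈ A_F(m) forces y_j = θ(φ(x_j)) to agree with θ(x_j) = 1 + X_j in
  -- degrees 1..m: φ(x_j) x_j⁻¹ ∈ F_{m+1} says (θφ̂θ⁻¹ G)·G⁻¹ ≡ 1 = G·G⁻¹ up to
  -- degree m for G = θ(x_j), and right multiplication by G⁻¹ is injective.
  generators-low : (y : Fin r → Series r) (m : ℕ) → InA p y m →
    ∀ j (c : Word r) → 0 < length c → length c ≤ m → y j c ≈ genS j c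
  generators-low y m φ∈A j (x ∷ c) _ |c|≤m = ≈-trans (≈-sym (substS-genS y j x c))
    (mulS-cancelʳ (substS p y G) G (invS p G) m ≈-refl agree (x ∷ c) |c|≤m)
    where
    G = genS j
    agree : ∀ w → length w ≤ m → mulS (substS p y G) (invS p G) w ≈ mulS G (invS p G) w
    agree w |w|≤m = ≈-trans (minusOne≈0 (commS p y G) w (proj₂ (φ∈A G (genS-InF j)) w (s≤s |w|≤m)))
      (≈-sym (inverse G ≈-refl w))

  module LowDegrees (y : Fin r → Series r) (m : ℕ) (y₀ : ∀ j → y j [] ≈ 1)
    (y-low : ∀ j (c : Word r) → 0 < length c → length c ≤ m → y j c ≈ genS j c) where

    z : Fin r → Series r
    z j = minusOne p (y j)

    P : Word r → Series r
    P = zMonomial y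

    z-low : ∀ j (c : Word r) → length c ≤ m → z j c ≈ δ (j ∷ []) c
    z-low j [] _ = ≈-trans (+-≈ (y₀ j) (≈-refl {neg p 1})) (neg-inverse 1)
    z-low j (x ∷ []) |c|≤m = y-low j (x ∷ []) (s≤s z≤n) |c|≤m
    z-low j (x ∷ x′ ∷ c) |c|≤m =
      ≈-trans (y-low j (x ∷ x′ ∷ c) (s≤s z≤n) |c|≤m) (≡⇒≈ (sym (if-same (does (x ≟ᶠ j)))))

    below-top : (w : Word r) → length w ≡ suc m → (c : Word r) → length c < length w → length c ≤ m
    below-top w |w|≡1+m c |c|<|w| = ≤-pred (subst (length c <_) |w|≡1+m |c|<|w|)

    monomial-low : ∀ u (b : Word r) → length b ≤ m → P u b ≈ δ u b
    monomial-low [] b _ = ≡⇒≈ (sym (δ-nil b))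
    monomial-low (a ∷ u) b |b|≤m = begin
      mulS (z a) (P u) b          ≈⟨ mulS-cong (z a) (δ (a ∷ [])) (P u) (δ u) b
                                       (λ c |c|≤|b| → z-low a c (≤-trans |c|≤|b| |b|≤m))
                                       (λ d |d|≤|b| → monomial-low u d (≤-trans |d|≤|b| |b|≤m)) ⟩
      mulS (δ (a ∷ [])) (δ u) b   ≡⟨ δ-mul a u b ⟩
      δ (a ∷ u) b                 ∎

    -- ... and also in degree m + 1 when |u| ≥ 2: every factorisation of w then
    -- meets each of the two factors in a degree between 1 and m.
    monomial-top : ∀ a b u (w : Word r) → length w ≡ suc m → P (a ∷ b ∷ u) w ≈ δ (a ∷ b ∷ u) w
    monomial-top a b u w |w|≡1+m = ≈-trans
      (mulS-cong-augmented (z a) (δ (a ∷ [])) (P (b ∷ u)) (δ (b ∷ u)) w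
        (z-low a [] z≤n) ≈-refl (monomial-low (b ∷ u) [] z≤n) ≈-refl
        (λ c |c|<|w| → z-low a c (below c |c|<|w|)) (λ d |d|<|w| → monomial-low (b ∷ u) d (below d |d|<|w|)))
      (≡⇒≈ (δ-mul a (b ∷ u) w))
      where below = below-top w |w|≡1+m

    substS-low : (s : Series r) (c : Word r) → length c ≤ m → substS p y s c ≈ s c
    substS-low s c |c|≤m = ≈-trans
      (sum-cong-≈ (λ u → s u * P u c) (λ u → s u * δ u c)
        (λ u → *-≈ (≈-refl {s u}) (monomial-low u c |c|≤m)) (wordsUpTo r (length c)))
      (≡⇒≈ (sift-wordsUpTo s (length c) c ≤-refl))

    linear-correction : Series r → Word r → ℕ
    linear-correction s w = sumFin (λ i → s (i ∷ []) * y i w)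

    substS-top : (s : Series r) (x x′ : Fin r) (v : Word r) → length (x ∷ x′ ∷ v) ≡ suc m →
      substS p y s (x ∷ x′ ∷ v) ≈ s (x ∷ x′ ∷ v) + linear-correction s (x ∷ x′ ∷ v)
    substS-top s x x′ v |w|≡1+m = begin
      sumL (map (λ u → s u * P u w) ws)
        ≈⟨ sum-cong-≈ _ (λ u → s u * (δ u w + δ₁ u)) (λ u → *-≈ (≈-refl {s u}) (P≈δ+δ₁ u)) ws ⟩
      sumL (map (λ u → s u * (δ u w + δ₁ u)) ws)
        ≡⟨ sum-cong _ (λ u → s u * δ u w + s u * δ₁ u) (λ u → *-distribˡ-+ (s u) (δ u w) (δ₁ u)) ws ⟩
      sumL (map (λ u → s u * δ u w + s u * δ₁ u) ws)
        ≡⟨ sum-+ (λ u → s u * δ u w) (λ u → s u * δ₁ u) ws ⟩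
      sumL (map (λ u → s u * δ u w) ws) + sumL (map (λ u → s u * δ₁ u) ws)
        ≡⟨ cong₂ _+_ (sift-wordsUpTo s (length w) w ≤-refl)
             (sum-wordsUpTo-letters (λ u → s u * δ₁ u) (*-zeroʳ (s [])) (λ a b u → *-zeroʳ (s (a ∷ b ∷ u))) (suc (length v))) ⟩
      s w + linear-correction s w ∎
      where
      w = x ∷ x′ ∷ v
      ws = wordsUpTo r (length w)
      -- z_u(w) ≡ δ u w + δ₁ u: only the letters u = X_i deviate, by y_i(w)
      δ₁ : Word r → ℕ
      δ₁ [] = 0
      δ₁ (i ∷ []) = y i w
      δ₁ (_ ∷ _ ∷ _) = 0
      P≈δ+δ₁ : ∀ u → P u w ≈ δ u w + δ₁ u
      P≈δ+δ₁ [] = ≈-refl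
      P≈δ+δ₁ (i ∷ []) = ≡⇒≈ (trans (mulS-identityʳ (z i) w) (sym (cong (_+ y i w) (if-same (does (x ≟ᶠ i))))))
      P≈δ+δ₁ (a ∷ b ∷ u) = ≈-trans (monomial-top a b u w |w|≡1+m) (≡⇒≈ (sym (+-identityʳ _)))

    -- The degree-(m+1) coefficient of φ(f) f⁻¹ is the linear correction of θ(f):
    -- θφ̂θ⁻¹ θ(f) agrees with θ(f) below degree m+1, so exchanging the top
    -- coefficient in (θφ̂θ⁻¹ θ(f))·θ(f)⁻¹ against θ(f)·θ(f)⁻¹ = 1 leaves it.
    commS-top : (f : Series r) → f [] ≈ 1 → (x x′ : Fin r) (v : Word r) → length (x ∷ x′ ∷ v) ≡ suc m →
      commS p y f (x ∷ x′ ∷ v) ≈ linear-correction f (x ∷ x′ ∷ v)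
    commS-top f f₀ x x′ v |w|≡1+m = +-cancelʳ-≈ (f w) (begin
      mulS S I w + f w        ≡⟨ cong (mulS S I w +_) (sym (*-identityʳ (f w))) ⟩
      mulS S I w + f w * I [] ≈⟨ mulS-exchange-top S f I w (λ c |c|<|w| → substS-low f c (below-top w |w|≡1+m c |c|<|w|)) ⟩
      mulS f I w + S w * I [] ≈⟨ +-≈ (inverse f f₀ w) (*-≈ (substS-top f x x′ v |w|≡1+m) (≈-refl {1})) ⟩
      0 + (f w + D) * 1       ≡⟨ trans (*-identityʳ _) (+-comm (f w) D) ⟩
      D + f w                 ∎)
      where
      w = x ∷ x′ ∷ v
      S = substS p y f
      I = invS p f
      D = linear-correction f w

    linAct-identity : 1 ≤ m → (h′ : Hvec r) (i : Fin r) → linAct y h′ i ≈ h′ i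
    linAct-identity 1≤m h′ i = begin
      sumFin (λ j → y j (i ∷ []) * h′ j)      ≈⟨ sumFin-cong-≈ _ _ (λ j → *-≈ (y-low j (i ∷ []) (s≤s z≤n) 1≤m) (≈-refl {h′ j})) ⟩
      sumFin (λ j → genS j (i ∷ []) * h′ j)   ≡⟨ sumFin-delta i _ (λ j j≢i → cong (_* h′ j) (if-no (i ≟ᶠ j) (λ e → j≢i (sym e)))) ⟩
      genS i (i ∷ []) * h′ i                  ≡⟨ trans (cong (_* h′ i) (if-yes (i ≟ᶠ i) refl)) (*-identityˡ (h′ i)) ⟩
      h′ i                                    ∎

proposition4p1p18 : (p : ℕ) → Prime p → (r m : ℕ) → 1 ≤ m →
    (y : Fin r → Series r) → IsAut p y → InA p y m →
    (h : Hvec r) → (f : Series r) → InF p f → (∀ i → theta1 f i ≡[ p ] h i) →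
    (h' : Hvec r) → (∀ i → linAct y h' i ≡[ p ] h i) →
    (w : Word r) → length w ≡ suc m →
    tauThetaS p y h h' w ≡[ p ] commS p y f w
proposition4p1p18 zero p-prime = ⊥-elim (≢-nonZero⁻¹ 0 {{prime⇒nonZero p-prime}} refl)
proposition4p1p18 (suc q) _ r m 1≤m y φ∈Aut φ∈A h f f∈F f≡h h′ φh′≡h [] ()
proposition4p1p18 (suc q) _ r m 1≤m y φ∈Aut φ∈A h f f∈F f≡h h′ φh′≡h (x ∷ []) |w|≡1+m =
  ⊥-elim (<-irrefl (suc-injective |w|≡1+m) 1≤m)
proposition4p1p18 (suc q) _ r m 1≤m y φ∈Aut φ∈A h f f∈F f≡h h′ φh′≡h (x ∷ x′ ∷ v) |w|≡1+m =
  ≈⇒≡[p] (begin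
    tauThetaS p y h h′ w                   ≡⟨ trans (cong (substS p y (linS h′) w +_) (*-zeroʳ q)) (+-identityʳ _) ⟩
    substS p y (linS h′) w                 ≈⟨ substS-top (linS h′) x x′ v |w|≡1+m ⟩
    0 + linear-correction (linS h′) w      ≈⟨ sumFin-cong-≈ _ _ (λ i → *-≈ (h′≈f i) (≈-refl {y i w})) ⟩
    linear-correction f w                  ≈⟨ ≈-sym (commS-top f (InF-constant f f∈F) x x′ v |w|≡1+m) ⟩
    commS p y f w                          ∎)
  where
  open Modular q
  open SetoidReasoning ≈-setoid
  open LowDegrees y m (λ j → InF-constant (y j) (proj₁ φ∈Aut j)) (generators-low y m φ∈A)
  w = x ∷ x′ ∷ v
  -- [φ]h′ = h and [φ] = id give h′ ≡ h ≡ θ₁(f).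
  h′≈f : ∀ i → h′ i ≈ f (i ∷ [])
  h′≈f i = ≈-trans (≈-sym (linAct-identity 1≤m h′ i)) (≈-trans (≡[p]⇒≈ (φh′≡h i)) (≈-sym (≡[p]⇒≈ (f≡h i))))
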